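{- If a finite simple graph $G$ is positive, then there exists an even homomorphism of $G$ into itself.
   Context: A simple graph $G$ is positive if $\hom(G,H)=\sum_{\varphi:V(G)\to V(H)}\prod_{uv\in E(G)}\beta_{\varphi(u)\varphi(v)}\ge0$ for every graph $H$ with real (possibly negative) symmetric edge weights $\beta$, loops allowed. A homomorphism $\varphi:G\to G$ is a map $V(G)\to V(G)$ preserving adjacency; it is even if for every edge $xy\in E(G)$ the number of edges $uv\in E(G)$ with $\{\varphi(u),\varphi(v)\}=\{x,y\}$ is even. -}

module Defs where

open import Data.Nat using (ℕ; zero; suc)
open import Data.Nat.Divisibility using (_∣_)
open import Data.Bool using (Bool; true; false; _∧_; _∨_)
open import Data.Fin using (Fin; zero; suc; _<?_; _≟_)
open import Data.List using (List; []; _∷_; [_]; map; concatMap; filterᵇ; cartesianProduct; foldr; length; allFin)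
open import Data.Product using (_×_; _,_; Σ)
open import Data.Rational using (ℚ; 0ℚ; 1ℚ; _+_; _*_; _≤_)
open import Relation.Nullary.Decidable using (⌊_⌋)
open import Relation.Binary.PropositionalEquality using (_≡_)

record SimpleGraph : Set where
  field
    n      : ℕ
    adj    : Fin n → Fin n → Bool
    sym    : ∀ u v → adj u v ≡ adj v u
    irrefl : ∀ v → adj v v ≡ false

open SimpleGraph public

edges : (G : SimpleGraph) → List (Fin (n G) × Fin (n G))
edges G = filterᵇ (λ { (u , v) → ⌊ u <? v ⌋ ∧ adj G u v })
                  (cartesianProduct (allFin (n G)) (allFin (n G)))

-- A finite weighted graph H on Fin m with symmetric rational edge weights
-- (loops allowed: β i i may be nonzero; weights may be negative).
record WeightedGraph : Set where
  field
    m     : ℕ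
    β     : Fin m → Fin m → ℚ
    βsym  : ∀ i j → β i j ≡ β j i

open WeightedGraph public

allMaps : (k l : ℕ) → List (Fin k → Fin l)
allMaps zero    l = [ (λ ()) ]
allMaps (suc k) l =
  concatMap (λ f → map (λ i → λ { zero → i ; (suc x) → f x }) (allFin l)) (allMaps k l)

sumℚ : List ℚ → ℚ
sumℚ = foldr _+_ 0ℚ

prodℚ : List ℚ → ℚ
prodℚ = foldr _*_ 1ℚ

hom : SimpleGraph → WeightedGraph → ℚ
hom G H = sumℚ (map (λ φ → prodℚ (map (λ { (u , v) → β H (φ u) (φ v) }) (edges G)))
                    (allMaps (n G) (m H)))

IsPositive : SimpleGraph → Set
IsPositive G = ∀ (H : WeightedGraph) → 0ℚ ≤ hom G H

IsHomomorphism : (G : SimpleGraph) → (Fin (n G) → Fin (n G)) → Set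
IsHomomorphism G φ = ∀ u v → adj G u v ≡ true → adj G (φ u) (φ v) ≡ true

preimageCount : (G : SimpleGraph) → (Fin (n G) → Fin (n G)) → Fin (n G) → Fin (n G) → ℕ
preimageCount G φ x y =
  length (filterᵇ (λ { (u , v) → (⌊ φ u ≟ x ⌋ ∧ ⌊ φ v ≟ y ⌋) ∨ (⌊ φ u ≟ y ⌋ ∧ ⌊ φ v ≟ x ⌋) })
                  (edges G))

IsEven : (G : SimpleGraph) → (Fin (n G) → Fin (n G)) → Set
IsEven G φ = ∀ x y → adj G x y ≡ true → 2 ∣ preimageCount G φ x y

module Submission where

open import Defs
open import Data.Fin using (Fin)
open import Data.Product using (Σ; _×_)

-- Write E for the edge list of G, and for a symmetric weight matrix w on V(G)
-- let  weight φ w = ∏_{uv ∈ E} w(φu, φv),  so that  hom(G, H_w) = Σ_φ weight φ w.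
-- For a list F of vertex pairs, evenSum F w is the same sum restricted to the maps
-- φ whose preimage count over every pair of F is even.  Negating w on the single
-- pair {a,b} multiplies weight φ w by (-1)^(preimage count of {a,b}), so averaging
-- w and its negation kills the odd maps:
--     evenSum F w + evenSum F (negateAt a b w) = 2 · evenSum ((a,b) ∷ F) w.
-- By induction on F, positivity of G gives evenSum F w ≥ 0 for every F, and then
-- evenSum ((a,b) ∷ F) w ≥ evenSum F w / 2, so positivity of evenSum [] w persists
-- to every F.  For the adjacency matrix w of G, evenSum [] w ≥ weight id w = 1.
-- Hence evenSum E w > 0, and a map with nonzero contribution is even on every edge
-- and sends edges to edges: an even homomorphism.

open import Data.Bool using (Bool; true; false; T; not; _∧_; _∨_; if_then_else_)
import Data.Bool.Properties as BoolP
open import Data.Empty using (⊥-elim)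
open import Data.Fin using (zero; suc; _≟_; _<?_) renaming (_<_ to _<ᶠ_)
import Data.Fin.Properties as FinP
open import Data.List using (List; []; _∷_; map; filterᵇ; length; allFin; cartesianProduct)
import Data.List.Properties as ListP
open import Data.List.Membership.Propositional using (_∈_)
open import Data.List.Membership.Propositional.Properties
  using (∈-map⁺; ∈-concatMap⁺; ∈-filter⁺; ∈-filter⁻; ∈-allFin; ∈-cartesianProduct⁺)
import Data.List.Relation.Unary.Any as Any
open import Data.List.Relation.Unary.Any using (here; there)
open import Data.Nat using (ℕ; zero; suc)
open import Data.Nat.Divisibility using (_∣_; divides; ∣-refl; ∣m∣n⇒∣m+n)
open import Data.Product using (_,_; proj₂)
open import Data.Sum using (_⊎_; inj₁; inj₂)
open import Data.Rational using (ℚ; 0ℚ; 1ℚ; _+_; _*_; -_; _≤_; _<_; nonNegative)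
import Data.Rational.Properties as ℚP
open import Data.Rational.Solver using (module +-*-Solver)
open import Function using (_∘_)
open import Function.Bundles using (Equivalence)
open import Relation.Binary using (tri<; tri≈; tri>)
open import Relation.Binary.PropositionalEquality
  using (_≡_; _≢_; refl; trans; cong; cong₂; subst; ≢-sym)
  renaming (sym to ≡-sym)
open import Relation.Nullary using (yes; no)
open import Relation.Nullary.Decidable using (⌊_⌋; T?; fromWitness)

open +-*-Solver

module _ {A : Set} (p : A → Bool) where

  ∈-filterᵇ⁺ : ∀ {x xs} → x ∈ xs → p x ≡ true → x ∈ filterᵇ p xs
  ∈-filterᵇ⁺ x∈xs px = ∈-filter⁺ (T? ∘ p) x∈xs (Equivalence.from BoolP.T-≡ px)

  ∈-filterᵇ⁻ : ∀ {x xs} → x ∈ filterᵇ p xs → p x ≡ true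
  ∈-filterᵇ⁻ {xs = xs} x∈ = Equivalence.to BoolP.T-≡ (proj₂ (∈-filter⁻ (T? ∘ p) {xs = xs} x∈))

filterᵇ-cong : ∀ {A : Set} (p q : A → Bool) → (∀ x → p x ≡ q x) →
  ∀ xs → filterᵇ p xs ≡ filterᵇ q xs
filterᵇ-cong p q p≗q = ListP.filter-≐ (T? ∘ p) (T? ∘ q)
  ((λ {x} → subst T (p≗q x)) , (λ {x} → subst T (≡-sym (p≗q x))))

true≢false : true ≢ false
true≢false ()

allMaps-complete : ∀ k l (f : Fin k → Fin l) →
  Σ (Fin k → Fin l) (λ g → g ∈ allMaps k l × (∀ x → g x ≡ f x))
allMaps-complete zero    l f = _ , here refl , λ ()
allMaps-complete (suc k) l f with allMaps-complete k l (f ∘ suc)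
... | g , g∈ , g≗f =
  _ , ∈-concatMap⁺ _ (Any.map (λ { refl → ∈-map⁺ _ (∈-allFin (f zero)) }) g∈) , agree
  where
    agree : ∀ x → _ ≡ f x
    agree zero    = refl
    agree (suc x) = g≗f x

q≤q+p : ∀ {p q} → 0ℚ ≤ p → q ≤ q + p
q≤q+p {p} {q} 0≤p = subst (_≤ q + p) (ℚP.+-identityʳ q) (ℚP.+-monoʳ-≤ q 0≤p)

*-nonneg : ∀ {p q} → 0ℚ ≤ p → 0ℚ ≤ q → 0ℚ ≤ p * q
*-nonneg {p} {q} 0≤p 0≤q = ℚP.nonNegative⁻¹ (p * q)
  {{ℚP.nonNeg*nonNeg⇒nonNeg p {{nonNegative 0≤p}} q {{nonNegative 0≤q}}}}

double-nonneg : ∀ a → 0ℚ ≤ a + a → 0ℚ ≤ a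
double-nonneg a 0≤2a with 0ℚ ℚP.≤? a
... | yes 0≤a = 0≤a
... | no 0≰a  = ⊥-elim (ℚP.<-irrefl refl (ℚP.<-≤-trans (ℚP.+-mono-< a<0 a<0) 0≤2a))
  where a<0 = ℚP.≰⇒> 0≰a

double-pos : ∀ a → 0ℚ < a + a → 0ℚ < a
double-pos a 0<2a with 0ℚ ℚP.<? a
... | yes 0<a = 0<a
... | no 0≮a  = ⊥-elim (ℚP.<-irrefl refl (ℚP.<-≤-trans 0<2a (ℚP.+-mono-≤ a≤0 a≤0)))
  where a≤0 = ℚP.≮⇒≥ 0≮a

module _ {A : Set} where

  sumℚ-cong : (xs : List A) (f g : A → ℚ) → (∀ x → f x ≡ g x) →
    sumℚ (map f xs) ≡ sumℚ (map g xs)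
  sumℚ-cong []       f g f≗g = refl
  sumℚ-cong (x ∷ xs) f g f≗g = cong₂ _+_ (f≗g x) (sumℚ-cong xs f g f≗g)

  sumℚ-+ : (xs : List A) (f g : A → ℚ) →
    sumℚ (map f xs) + sumℚ (map g xs) ≡ sumℚ (map (λ x → f x + g x) xs)
  sumℚ-+ []       f g = refl
  sumℚ-+ (x ∷ xs) f g = trans
    (solve 4 (λ a b c d → (a :+ b) :+ (c :+ d) := (a :+ c) :+ (b :+ d)) refl
      (f x) (sumℚ (map f xs)) (g x) (sumℚ (map g xs)))
    (cong ((f x + g x) +_) (sumℚ-+ xs f g))

  sumℚ-nonneg : (xs : List A) (f : A → ℚ) → (∀ x → 0ℚ ≤ f x) → 0ℚ ≤ sumℚ (map f xs)
  sumℚ-nonneg []       f f≥0 = ℚP.≤-refl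
  sumℚ-nonneg (x ∷ xs) f f≥0 = ℚP.+-mono-≤ (f≥0 x) (sumℚ-nonneg xs f f≥0)

  sumℚ-≥-term : (xs : List A) (f : A → ℚ) → (∀ x → 0ℚ ≤ f x) →
    ∀ {x} → x ∈ xs → f x ≤ sumℚ (map f xs)
  sumℚ-≥-term (y ∷ xs) f f≥0 (here refl) = q≤q+p (sumℚ-nonneg xs f f≥0)
  sumℚ-≥-term (y ∷ xs) f f≥0 (there x∈) = ℚP.≤-trans (sumℚ-≥-term xs f f≥0 x∈)
    (subst (_ ≤_) (ℚP.+-comm _ (f y)) (q≤q+p (f≥0 y)))

  sumℚ-nonzero : (xs : List A) (f : A → ℚ) → sumℚ (map f xs) ≢ 0ℚ → Σ A (λ x → f x ≢ 0ℚ)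
  sumℚ-nonzero []       f sum≢0 = ⊥-elim (sum≢0 refl)
  sumℚ-nonzero (x ∷ xs) f sum≢0 with f x ℚP.≟ 0ℚ
  ... | no fx≢0  = x , fx≢0
  ... | yes fx≡0 = sumℚ-nonzero xs f λ rest≡0 →
    sum≢0 (cong₂ _+_ fx≡0 rest≡0)

  prodℚ-nonneg : (xs : List A) (f : A → ℚ) → (∀ x → 0ℚ ≤ f x) → 0ℚ ≤ prodℚ (map f xs)
  prodℚ-nonneg []       f f≥0 = ℚP.<⇒≤ (ℚP.positive⁻¹ 1ℚ)
  prodℚ-nonneg (x ∷ xs) f f≥0 = *-nonneg (f≥0 x) (prodℚ-nonneg xs f f≥0)

  prodℚ-one : (xs : List A) (f : A → ℚ) → (∀ x → x ∈ xs → f x ≡ 1ℚ) → prodℚ (map f xs) ≡ 1ℚ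
  prodℚ-one []       f f≡1 = refl
  prodℚ-one (x ∷ xs) f f≡1 =
    cong₂ _*_ (f≡1 x (here refl)) (prodℚ-one xs f (λ y y∈ → f≡1 y (there y∈)))

  prodℚ-nonzero : (xs : List A) (f : A → ℚ) → prodℚ (map f xs) ≢ 0ℚ →
    ∀ {x} → x ∈ xs → f x ≢ 0ℚ
  prodℚ-nonzero (y ∷ xs) f prod≢0 (here refl) fy≡0 =
    prod≢0 (trans (cong (_* prodℚ (map f xs)) fy≡0) (ℚP.*-zeroˡ (prodℚ (map f xs))))
  prodℚ-nonzero (y ∷ xs) f prod≢0 (there x∈) =
    prodℚ-nonzero xs f (λ rest≡0 → prod≢0 (trans (cong (f y *_) rest≡0) (ℚP.*-zeroʳ (f y)))) x∈

evenᵇ : ℕ → Bool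
evenᵇ zero    = true
evenᵇ (suc k) = not (evenᵇ k)

evenᵇ⇒2∣ : ∀ k → evenᵇ k ≡ true → 2 ∣ k
evenᵇ⇒2∣ zero          _      = divides 0 refl
evenᵇ⇒2∣ (suc zero)    ()
evenᵇ⇒2∣ (suc (suc k)) even = ∣m∣n⇒∣m+n ∣-refl
  (evenᵇ⇒2∣ k (trans (≡-sym (BoolP.not-involutive (evenᵇ k))) even))

sign : ℕ → ℚ
sign k = if evenᵇ k then 1ℚ else - 1ℚ

sign-suc : ∀ k → sign (suc k) ≡ - sign k
sign-suc k with evenᵇ k
... | true  = refl
... | false = refl

prodℚ-negate : ∀ {A : Set} (q : A → Bool) (f : A → ℚ) (xs : List A) →
  prodℚ (map (λ x → if q x then - f x else f x) xs) ≡
  sign (length (filterᵇ q xs)) * prodℚ (map f xs)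
prodℚ-negate q f []       = refl
prodℚ-negate q f (x ∷ xs) with q x
... | true  = trans (cong (- f x *_) (prodℚ-negate q f xs))
  (trans (solve 3 (λ a s p → (:- a) :* (s :* p) := (:- s) :* (a :* p)) refl
           (f x) (sign (length (filterᵇ q xs))) (prodℚ (map f xs)))
         (cong (_* (f x * prodℚ (map f xs))) (≡-sym (sign-suc (length (filterᵇ q xs))))))
... | false = trans (cong (f x *_) (prodℚ-negate q f xs))
  (solve 3 (λ a s p → a :* (s :* p) := s :* (a :* p)) refl
    (f x) (sign (length (filterᵇ q xs))) (prodℚ (map f xs)))

module EvenSums (G : SimpleGraph) where

  V : Set
  V = Fin (n G)

  Weight : Set
  Weight = V → V → ℚ

  IsSymmetric : Weight → Set
  IsSymmetric w = ∀ x y → w x y ≡ w y x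

  weight : (V → V) → Weight → ℚ
  weight φ w = prodℚ (map (λ { (u , v) → w (φ u) (φ v) }) (edges G))

  evenOn : List (V × V) → (V → V) → Bool
  evenOn []            φ = true
  evenOn ((a , b) ∷ F) φ = evenᵇ (preimageCount G φ a b) ∧ evenOn F φ

  evenTerm : List (V × V) → Weight → (V → V) → ℚ
  evenTerm F w φ = if evenOn F φ then weight φ w else 0ℚ

  evenSum : List (V × V) → Weight → ℚ
  evenSum F w = sumℚ (map (evenTerm F w) (allMaps (n G) (n G)))

  hits : V → V → V → V → Bool
  hits a b x y = (⌊ x ≟ a ⌋ ∧ ⌊ y ≟ b ⌋) ∨ (⌊ x ≟ b ⌋ ∧ ⌊ y ≟ a ⌋)

  hits-sym : ∀ a b x y → hits a b x y ≡ hits a b y x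
  hits-sym a b x y = trans (BoolP.∨-comm (⌊ x ≟ a ⌋ ∧ ⌊ y ≟ b ⌋) _)
    (cong₂ _∨_ (BoolP.∧-comm (⌊ x ≟ b ⌋) _) (BoolP.∧-comm (⌊ x ≟ a ⌋) _))

  negateAt : V → V → Weight → Weight
  negateAt a b w x y = if hits a b x y then - w x y else w x y

  negateAt-sym : ∀ a b w → IsSymmetric w → IsSymmetric (negateAt a b w)
  negateAt-sym a b w w-sym x y rewrite hits-sym a b x y | w-sym x y = refl

  weight-negateAt : ∀ φ a b w →
    weight φ (negateAt a b w) ≡ sign (preimageCount G φ a b) * weight φ w
  weight-negateAt φ a b w = prodℚ-negate
    (λ { (u , v) → hits a b (φ u) (φ v) }) (λ { (u , v) → w (φ u) (φ v) }) (edges G)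

  evenTerm-negateAt : ∀ a b F w φ →
    evenTerm F w φ + evenTerm F (negateAt a b w) φ ≡
    evenTerm ((a , b) ∷ F) w φ + evenTerm ((a , b) ∷ F) w φ
  evenTerm-negateAt a b F w φ with evenOn F φ
  ... | false rewrite BoolP.∧-zeroʳ (evenᵇ (preimageCount G φ a b)) = refl
  ... | true rewrite weight-negateAt φ a b w with evenᵇ (preimageCount G φ a b)
  ...   | true  rewrite ℚP.*-identityˡ (weight φ w) = refl
  ...   | false = solve 1 (λ t → t :+ ((:- con 1ℚ) :* t) := con 0ℚ :+ con 0ℚ) refl (weight φ w)

  -- Averaging w with its negation at {a,b} keeps exactly the maps even on {a,b}.
  evenSum-negateAt : ∀ a b F w →
    evenSum F w + evenSum F (negateAt a b w) ≡
    evenSum ((a , b) ∷ F) w + evenSum ((a , b) ∷ F) w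
  evenSum-negateAt a b F w = trans (sumℚ-+ maps _ _)
    (trans (sumℚ-cong maps _ _ (evenTerm-negateAt a b F w)) (≡-sym (sumℚ-+ maps _ _)))
    where maps = allMaps (n G) (n G)

  evenSum-nonneg : IsPositive G → ∀ F w → IsSymmetric w → 0ℚ ≤ evenSum F w
  evenSum-nonneg pos []            w w-sym = pos (record { m = n G ; β = w ; βsym = w-sym })
  evenSum-nonneg pos ((a , b) ∷ F) w w-sym = double-nonneg _
    (subst (0ℚ ≤_) (evenSum-negateAt a b F w)
      (ℚP.+-mono-≤ (evenSum-nonneg pos F w w-sym)
                   (evenSum-nonneg pos F (negateAt a b w) (negateAt-sym a b w w-sym))))

  -- Restricting to even maps preserves strict positivity of the sum, since each
  -- step at least halves it.
  evenSum-pos : IsPositive G → ∀ F w → IsSymmetric w → 0ℚ < evenSum [] w → 0ℚ < evenSum F w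
  evenSum-pos pos []            w w-sym 0<S = 0<S
  evenSum-pos pos ((a , b) ∷ F) w w-sym 0<S = double-pos _
    (subst (0ℚ <_) (evenSum-negateAt a b F w)
      (ℚP.<-≤-trans (evenSum-pos pos F w w-sym 0<S)
        (q≤q+p (evenSum-nonneg pos F (negateAt a b w) (negateAt-sym a b w w-sym)))))

  ∈edges⇒adj : ∀ {u v} → (u , v) ∈ edges G → adj G u v ≡ true
  ∈edges⇒adj {u} {v} uv∈E =
    BoolP.∧-conicalʳ _ _ (∈-filterᵇ⁻ _ {xs = cartesianProduct (allFin (n G)) (allFin (n G))} uv∈E)

  ordered⇒∈edges : ∀ {u v} → u <ᶠ v → adj G u v ≡ true → (u , v) ∈ edges G
  ordered⇒∈edges {u} {v} u<v uv = ∈-filterᵇ⁺ _ (∈-cartesianProduct⁺ (∈-allFin u) (∈-allFin v))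
    (trans (cong (_∧ adj G u v) (Equivalence.to BoolP.T-≡ (fromWitness u<v))) uv)

  adj⇒∈edges : ∀ u v → adj G u v ≡ true → (u , v) ∈ edges G ⊎ (v , u) ∈ edges G
  adj⇒∈edges u v uv with FinP.<-cmp u v
  ... | tri< u<v _ _  = inj₁ (ordered⇒∈edges u<v uv)
  ... | tri> _ _ v<u  = inj₂ (ordered⇒∈edges v<u (trans (SimpleGraph.sym G v u) uv))
  ... | tri≈ _ refl _ = ⊥-elim (true≢false (trans (≡-sym uv) (irrefl G u)))

  preimageCount-sym : ∀ φ x y → preimageCount G φ x y ≡ preimageCount G φ y x
  preimageCount-sym φ x y = cong length (filterᵇ-cong _ _
    (λ { (u , v) → BoolP.∨-comm (⌊ φ u ≟ x ⌋ ∧ ⌊ φ v ≟ y ⌋) _ }) (edges G))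

  evenOn-∈ : ∀ F φ → evenOn F φ ≡ true → ∀ {a b} → (a , b) ∈ F →
    evenᵇ (preimageCount G φ a b) ≡ true
  evenOn-∈ ((a , b) ∷ F) φ even (here refl) = BoolP.∧-conicalˡ _ _ even
  evenOn-∈ ((c , d) ∷ F) φ even (there ab∈F) =
    evenOn-∈ F φ (BoolP.∧-conicalʳ _ _ even) ab∈F

  evenOn-edges⇒IsEven : ∀ φ → evenOn (edges G) φ ≡ true → IsEven G φ
  evenOn-edges⇒IsEven φ even x y xy with adj⇒∈edges x y xy
  ... | inj₁ xy∈E = evenᵇ⇒2∣ _ (evenOn-∈ (edges G) φ even xy∈E)
  ... | inj₂ yx∈E = subst (2 ∣_) (preimageCount-sym φ y x)
                         (evenᵇ⇒2∣ _ (evenOn-∈ (edges G) φ even yx∈E))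

  adjWeight : Weight
  adjWeight x y = if adj G x y then 1ℚ else 0ℚ

  adjWeight-sym : IsSymmetric adjWeight
  adjWeight-sym x y rewrite SimpleGraph.sym G x y = refl

  adjWeight-nonneg : ∀ x y → 0ℚ ≤ adjWeight x y
  adjWeight-nonneg x y with adj G x y
  ... | true  = ℚP.<⇒≤ (ℚP.positive⁻¹ 1ℚ)
  ... | false = ℚP.≤-refl

  adjWeight-nonzero : ∀ x y → adjWeight x y ≢ 0ℚ → adj G x y ≡ true
  adjWeight-nonzero x y w≢0 with adj G x y
  ... | true  = refl
  ... | false = ⊥-elim (w≢0 refl)

  nonzero-weight⇒IsHomomorphism : ∀ φ → weight φ adjWeight ≢ 0ℚ → IsHomomorphism G φ
  nonzero-weight⇒IsHomomorphism φ weight≢0 u v uv with adj⇒∈edges u v uv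
  ... | inj₁ uv∈E = adjWeight-nonzero (φ u) (φ v) (prodℚ-nonzero (edges G) _ weight≢0 uv∈E)
  ... | inj₂ vu∈E = trans (SimpleGraph.sym G (φ u) (φ v))
    (adjWeight-nonzero (φ v) (φ u) (prodℚ-nonzero (edges G) _ weight≢0 vu∈E))

  -- hom(G, G) ≥ 1: all terms are nonnegative and the identity map contributes 1.
  evenSum-adj-pos : 0ℚ < evenSum [] adjWeight
  evenSum-adj-pos with allMaps-complete (n G) (n G) (λ x → x)
  ... | ι , ι∈ , ι≗id = ℚP.<-≤-trans (ℚP.positive⁻¹ 1ℚ)
    (subst (_≤ evenSum [] adjWeight) weight-ι
      (sumℚ-≥-term _ (λ φ → weight φ adjWeight) weight-nonneg ι∈))
    where
      weight-nonneg : ∀ φ → 0ℚ ≤ weight φ adjWeight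
      weight-nonneg φ = prodℚ-nonneg (edges G) _ (λ { (u , v) → adjWeight-nonneg (φ u) (φ v) })

      weight-ι : weight ι adjWeight ≡ 1ℚ
      weight-ι = prodℚ-one (edges G) _ λ { (u , v) uv∈E →
        trans (cong₂ adjWeight (ι≗id u) (ι≗id v))
              (cong (λ b → if b then 1ℚ else 0ℚ) (∈edges⇒adj uv∈E)) }

  nonzero-evenTerm⇒evenHom : ∀ φ → evenTerm (edges G) adjWeight φ ≢ 0ℚ →
    IsHomomorphism G φ × IsEven G φ
  nonzero-evenTerm⇒evenHom φ term≢0 with evenOn (edges G) φ in even
  ... | true  = nonzero-weight⇒IsHomomorphism φ term≢0 , evenOn-edges⇒IsEven φ even
  ... | false = ⊥-elim (term≢0 refl)

mainTheorem7 : (G : SimpleGraph) → IsPositive G →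
    Σ (Fin (n G) → Fin (n G)) (λ φ → IsHomomorphism G φ × IsEven G φ)
mainTheorem7 G pos =
  let φ , term≢0 = nonzeroTerm in φ , nonzero-evenTerm⇒evenHom φ term≢0
  where
    open EvenSums G

    evenSum-edges-pos : 0ℚ < evenSum (edges G) adjWeight
    evenSum-edges-pos = evenSum-pos pos (edges G) adjWeight adjWeight-sym evenSum-adj-pos

    nonzeroTerm : Σ (V → V) (λ φ → evenTerm (edges G) adjWeight φ ≢ 0ℚ)
    nonzeroTerm = sumℚ-nonzero (allMaps (n G) (n G)) (evenTerm (edges G) adjWeight)
      (≢-sym (ℚP.<⇒≢ evenSum-edges-pos))
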